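{- Let $D$ be a 3OBP with at most $k$ non-regular layers whose first and last layers of vertices have width $2$, and suppose $\lambda(D)\in[0.99,1]$. Then there is a partition of the vertices of $D$ into two sets such that every layer of vertices contains at least one vertex of each set, and at most $2k+1$ layers of edges contain an edge whose endpoints lie in different sets.
   Context: An ordered branching program (OBP) $D=D_1\circ\cdots\circ D_d$ is a layered directed graph with vertex layers $V_0,\dots,V_d$, where for each $i$ and each $u\in V_{i-1}$ there are two edges, labelled $0$ and $1$, to the vertices $D_i(u,0),D_i(u,1)\in V_i$ (layer $i$ of edges); a 3OBP has all $|V_i|\le3$. $D[x]$ is the $|V_0|\times|V_d|$ $0/1$ matrix with $D[x](u,v)=1$ iff following edges labelled $x_1,\dots,x_d$ from $u$ ends at $v$. Layer $i$ is regular if $|V_{i-1}|=|V_i|$ and $\mathbb{E}_U[D_i[U]]$ is doubly stochastic, non-regular otherwise. $\lambda(D)=\max\{\|x\,\mathbb{E}_U[D[U]]\|_2/\|x\|_2:x\in\mathbb{R}^{|V_0|}\setminus\{0\},\sum_ix_i=0\}$, $U$ uniform. -}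

module Defs where

open import Data.Bool using (Bool; true; false)
open import Data.Nat as ℕ using (ℕ; zero; suc)
open import Data.Fin using (Fin; zero; suc; inject₁; fromℕ; _≟_)
open import Data.Fin.Subset using (Subset; _∉_; ∣_∣)
open import Data.Integer using (+_)
open import Data.Rational using (ℚ; 0ℚ; 1ℚ; ½; _+_; _*_; _-_; _≤_; _/_)
open import Data.List using (List; []; _∷_; map; _++_; filter; length)
open import Data.Product using (Σ; _×_; ∃; ∃-syntax)
open import Relation.Binary.PropositionalEquality using (_≡_; _≢_)
open import Relation.Nullary using (¬_)

-- Ordered branching programs
-- An OBP of length d: vertex layers V_0..V_d with |V_i| = width i,
-- V_i = Fin (width i); edge layer i (i : Fin d, the paper's layer i+1)
-- maps (u ∈ V_i, bit b) to layer i+1.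

record OBP (d : ℕ) : Set where
  field
    width : Fin (suc d) → ℕ
    edge  : (i : Fin d) → Fin (width (inject₁ i)) → Bool → Fin (width (suc i))
open OBP public

Is3OBP : ∀ {d} → OBP d → Set
Is3OBP D = ∀ i → width D i ℕ.≤ 3

tailOBP : ∀ {d} → OBP (suc d) → OBP d
tailOBP D = record { width = λ i → width D (suc i) ; edge = λ i → edge D (suc i) }

run : ∀ {d} (D : OBP d) → (Fin d → Bool) → Fin (width D zero) → Fin (width D (fromℕ d))
run {zero}  D x u = u
run {suc d} D x u = run (tailOBP D) (λ i → x (suc i)) (edge D zero u (x zero))

sumℚ : ∀ {n} → (Fin n → ℚ) → ℚ
sumℚ {zero}  f = 0ℚ
sumℚ {suc n} f = f zero + sumℚ (λ i → f (suc i))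

ℕtoℚ : ℕ → ℚ
ℕtoℚ n = + n / 1

half^ : ℕ → ℚ
half^ zero    = 1ℚ
half^ (suc n) = ½ * half^ n

allBits : (d : ℕ) → List (Fin d → Bool)
allBits zero    = (λ ()) ∷ []
allBits (suc d) = map (λ x → cons false x) (allBits d) ++ map (λ x → cons true x) (allBits d)
  where
  cons : Bool → (Fin d → Bool) → Fin (suc d) → Bool
  cons b x zero    = b
  cons b x (suc i) = x i

-- E_U[D[U]] : the |V_0| × |V_d| matrix with entry (u,v) equal to
-- Pr_U[ following U from u ends at v ] = #{x ∈ {0,1}^d : D[x](u,v)=1} / 2^d

expectedMatrix : ∀ {d} (D : OBP d) → Fin (width D zero) → Fin (width D (fromℕ d)) → ℚ
expectedMatrix {d} D u v =
  ℕtoℚ (length (filter (λ x → run D x u ≟ v) (allBits d))) * half^ d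

layerMatrix : ∀ {d} (D : OBP d) (i : Fin d) →
              Fin (width D (inject₁ i)) → Fin (width D (suc i)) → ℚ
layerMatrix D i u v =
  ℕtoℚ (length (filter (λ b → edge D i u b ≟ v) (false ∷ true ∷ []))) * ½

DoublyStochastic : ∀ {m n} → (Fin m → Fin n → ℚ) → Set
DoublyStochastic {m} {n} M =
  (∀ u v → 0ℚ ≤ M u v) ×
  (∀ u → sumℚ (λ v → M u v) ≡ 1ℚ) ×
  (∀ v → sumℚ (λ u → M u v) ≡ 1ℚ)

Regular : ∀ {d} (D : OBP d) (i : Fin d) → Set
Regular D i = (width D (inject₁ i) ≡ width D (suc i)) × DoublyStochastic (layerMatrix D i)

AtMostNonRegular : ∀ {d} → ℕ → OBP d → Set
AtMostNonRegular {d} k D = ∃[ S ] (∣ S ∣ ℕ.≤ k × (∀ i → i ∉ S → Regular D i))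

-- λ(D), via its square, over row vectors x with Σ x_i = 0

rowTimes : ∀ {m n} → (Fin m → ℚ) → (Fin m → Fin n → ℚ) → Fin n → ℚ
rowTimes x M v = sumℚ (λ u → x u * M u v)

normSq : ∀ {n} → (Fin n → ℚ) → ℚ
normSq x = sumℚ (λ i → x i * x i)

LambdaAtMost1 : ∀ {d} → OBP d → Set
LambdaAtMost1 D = ∀ x → sumℚ x ≡ 0ℚ →
  normSq (rowTimes x (expectedMatrix D)) ≤ normSq x

-- λ(D) ≥ 0.99 : some nonzero x with Σx = 0 has ‖x E[D[U]]‖² ≥ 0.99² ‖x‖²
-- (the maximum is attained; when |V_0| = 2 the sum-zero space is spanned
--  by the rational vector (1,-1), so a rational witness is exact)
LambdaAtLeast099 : ∀ {d} → OBP d → Set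
LambdaAtLeast099 D = ∃[ x ] (sumℚ x ≡ 0ℚ × ¬ (∀ i → x i ≡ 0ℚ) ×
  ((+ 9801 / 10000) * normSq x ≤ normSq (rowTimes x (expectedMatrix D))))

Colouring : ∀ {d} → OBP d → Set
Colouring {d} D = (j : Fin (suc d)) → Fin (width D j) → Bool

BothInEveryLayer : ∀ {d} (D : OBP d) → Colouring D → Set
BothInEveryLayer {d} D c = ∀ j → (∃[ u ] c j u ≡ true) × (∃[ u ] c j u ≡ false)

LayerUncut : ∀ {d} (D : OBP d) → Colouring D → Fin d → Set
LayerUncut D c i = ∀ u b → c (inject₁ i) u ≡ c (suc i) (edge D i u b)

AtMostCutLayers : ∀ {d} (D : OBP d) → Colouring D → ℕ → Set
AtMostCutLayers {d} D c m = ∃[ S ] (∣ S ∣ ℕ.≤ m × (∀ i → i ∉ S → LayerUncut D c i))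

module Submission where

-- Since V₀ and V_d have two vertices, sum-zero vectors are multiples of (1, −1), and for the
-- row-stochastic E = E_U[D[U]] one has ‖xE‖² = ‖x‖² (E₀₀ − E₁₀)²; so λ(D) ≥ 0.99 yields a final
-- vertex t and initial vertices reaching t with probability ≤ 1/100 and ≥ 99/100.  The probability
-- ρ(w) of reaching t from w is the mean of ρ over the two successors of w, hence every layer keeps a
-- vertex with ρ ≤ 1/100 and one with ρ ≥ 99/100.  Colour w by whether ρ(w) ≥ 1/2.  In a regular layer
-- every vertex has in-degree 2, the successors of the low vertex are all below 1/2 and those of the
-- high vertex all above; if a third vertex had successors of both colours, each colour class would
-- receive three edges and so contain two vertices, too many for width 3.  Hence only the (at most k)
-- non-regular layers are cut.

open import Defs
open import Data.Bool using (Bool; true; false; not)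
open import Data.Fin using (Fin; zero; suc; inject₁; fromℕ; _≟_)
open import Data.Product using (_×_; _,_; proj₁; proj₂; ∃-syntax)
open import Function using (_∘_)
open import Relation.Binary.PropositionalEquality

module Counting where

  open import Data.Bool.Properties using (not-injective; ¬-not)
  import Data.Bool as Bool
  open import Data.List using ([]; _∷_; filter; length)
  open import Data.Nat using (ℕ; zero; suc; _+_; _*_; _≤_; z≤n; s≤s)
  open import Data.Nat.Properties
    using (+-*-semiring; +-comm; *-comm; *-zeroʳ; *-identityˡ; *-identityʳ; *-distribˡ-+; +-identityʳ;
           m≤m+n; m≤n+m; ≤-trans; ≤-reflexive; +-monoʳ-≤; +-mono-≤; <⇒≱; module ≤-Reasoning)
  open import Relation.Nullary using (does; yes; no; contradiction)
  open import Relation.Unary using (Decidable)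
  open import Algebra.Properties.Semiring.Sum +-*-semiring
    using (sum; sum-cong-≗; ∑-distrib-+; ∑-comm; *-distribˡ-sum; sum-replicate-zero)

  bitℕ : Bool → ℕ
  bitℕ false = 0
  bitℕ true  = 1

  bitℕ-+-not : ∀ b → bitℕ b + bitℕ (not b) ≡ 1
  bitℕ-+-not false = refl
  bitℕ-+-not true  = refl

  δ : ∀ {m} → Fin m → Fin m → ℕ
  δ w v = bitℕ (does (w ≟ v))

  sum-*-δ : ∀ {m} (g : Fin m → ℕ) w → sum (λ v → g v * δ w v) ≡ g w
  sum-*-δ {suc m} g zero = begin
    g zero * 1 + sum (λ v → g (suc v) * 0) ≡⟨ cong₂ _+_ (*-identityʳ (g zero)) (sum-cong-≗ {m} (*-zeroʳ ∘ g ∘ suc)) ⟩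
    g zero + sum {m} (λ _ → 0)             ≡⟨ cong (g zero +_) (sum-replicate-zero m) ⟩
    g zero + 0                             ≡⟨ +-identityʳ (g zero) ⟩
    g zero                                 ∎
    where open ≡-Reasoning
  sum-*-δ {suc m} g (suc w) =
    trans (cong (_+ sum (λ v → g (suc v) * δ w v)) (*-zeroʳ (g zero))) (sum-*-δ (g ∘ suc) w)

  sum-δ : ∀ {m} (w : Fin m) → sum (δ w) ≡ 1
  sum-δ {m} w = trans (sum-cong-≗ {m} (λ v → sym (*-identityˡ (δ w v)))) (sum-*-δ (λ _ → 1) w)

  length-filter-pair : ∀ {A : Set} {P : A → Set} (P? : Decidable P) x y →
    length (filter P? (x ∷ y ∷ [])) ≡ bitℕ (does (P? x)) + bitℕ (does (P? y))
  length-filter-pair P? x y with does (P? x)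
  ... | false with does (P? y)
  ...   | false = refl
  ...   | true  = refl
  length-filter-pair P? x y | true with does (P? y)
  ...   | false = refl
  ...   | true  = refl

  ≤-sum : ∀ {n} (f : Fin n → ℕ) i → f i ≤ sum f
  ≤-sum f zero    = m≤m+n (f zero) _
  ≤-sum f (suc i) = ≤-trans (≤-sum (f ∘ suc) i) (m≤n+m _ (f zero))

  +-≤-sum : ∀ {n} (f : Fin n → ℕ) {i j} → i ≢ j → f i + f j ≤ sum f
  +-≤-sum f {zero}  {zero}  i≢j = contradiction refl i≢j
  +-≤-sum f {zero}  {suc j} _   = +-monoʳ-≤ (f zero) (≤-sum (f ∘ suc) j)
  +-≤-sum f {suc i} {zero}  _   =
    ≤-trans (≤-reflexive (+-comm (f (suc i)) (f zero))) (+-monoʳ-≤ (f zero) (≤-sum (f ∘ suc) i))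
  +-≤-sum f {suc i} {suc j} i≢j = ≤-trans (+-≤-sum (f ∘ suc) (i≢j ∘ cong suc)) (m≤n+m _ (f zero))

  sum-ones : ∀ m → sum {m} (λ _ → 1) ≡ m
  sum-ones zero    = refl
  sum-ones (suc m) = cong suc (sum-ones m)

  trueCount : ∀ {m} → (Fin m → Bool) → ℕ
  trueCount c = sum (bitℕ ∘ c)

  trueCount-+-not : ∀ {m} (c : Fin m → Bool) → trueCount c + trueCount (not ∘ c) ≡ m
  trueCount-+-not {m} c = begin
    trueCount c + trueCount (not ∘ c)         ≡⟨ ∑-distrib-+ (bitℕ ∘ c) (bitℕ ∘ not ∘ c) ⟨
    sum (λ v → bitℕ (c v) + bitℕ (not (c v))) ≡⟨ sum-cong-≗ {m} (bitℕ-+-not ∘ c) ⟩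
    sum {m} (λ _ → 1)                         ≡⟨ sum-ones m ⟩
    m                                         ∎
    where open ≡-Reasoning

  module _ {n m} (e : Fin n → Bool → Fin m) where

    edgesBetween : Fin n → Fin m → ℕ
    edgesBetween u v = length (filter (λ b → e u b ≟ v) (false ∷ true ∷ []))

    indegree : Fin m → ℕ
    indegree v = sum (λ u → edgesBetween u v)

    sum-*-edgesBetween : ∀ (g : Fin m → ℕ) u →
      sum (λ v → g v * edgesBetween u v) ≡ g (e u false) + g (e u true)
    sum-*-edgesBetween g u = begin
      sum (λ v → g v * edgesBetween u v)
        ≡⟨ sum-cong-≗ {m} (λ v → cong (g v *_) (length-filter-pair (λ b → e u b ≟ v) false true)) ⟩
      sum (λ v → g v * (δ (e u false) v + δ (e u true) v))
        ≡⟨ sum-cong-≗ {m} (λ v → *-distribˡ-+ (g v) (δ (e u false) v) (δ (e u true) v)) ⟩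
      sum (λ v → g v * δ (e u false) v + g v * δ (e u true) v)
        ≡⟨ ∑-distrib-+ (λ v → g v * δ (e u false) v) (λ v → g v * δ (e u true) v) ⟩
      sum (λ v → g v * δ (e u false) v) + sum (λ v → g v * δ (e u true) v)
        ≡⟨ cong₂ _+_ (sum-*-δ g (e u false)) (sum-*-δ g (e u true)) ⟩
      g (e u false) + g (e u true) ∎
      where open ≡-Reasoning

    sum-successors : ∀ (g : Fin m → ℕ) →
      sum (λ u → g (e u false) + g (e u true)) ≡ sum (λ v → g v * indegree v)
    sum-successors g = begin
      sum (λ u → g (e u false) + g (e u true))
        ≡⟨ sum-cong-≗ {n} (λ u → sym (sum-*-edgesBetween g u)) ⟩
      sum (λ u → sum (λ v → g v * edgesBetween u v))
        ≡⟨ ∑-comm (λ u v → g v * edgesBetween u v) ⟩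
      sum (λ v → sum (λ u → g v * edgesBetween u v))
        ≡⟨ sum-cong-≗ {m} (λ v → sym (*-distribˡ-sum (g v) (λ u → edgesBetween u v))) ⟩
      sum (λ v → g v * indegree v) ∎
      where open ≡-Reasoning

    2≤trueCount : (∀ v → indegree v ≡ 2) → (c : Fin m → Bool) →
      ∀ {uH} → (∀ b → c (e uH b) ≡ true) → ∀ {u} → c (e u false) ≢ c (e u true) →
      2 ≤ trueCount c
    2≤trueCount indegree≡2 c {uH} uH-true {u} mixed = ⌈half⌉ (begin
      3                                   ≡⟨ cong₂ _+_ colours-uH colours-u ⟨
      colours uH + colours u              ≤⟨ +-≤-sum colours uH≢u ⟩
      sum colours                         ≡⟨ sum-successors (bitℕ ∘ c) ⟩
      sum (λ v → bitℕ (c v) * indegree v) ≡⟨ sum-cong-≗ {m} (λ v → cong (bitℕ (c v) *_) (indegree≡2 v)) ⟩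
      sum (λ v → bitℕ (c v) * 2)          ≡⟨ sum-cong-≗ {m} (λ v → *-comm (bitℕ (c v)) 2) ⟩
      sum (λ v → 2 * bitℕ (c v))          ≡⟨ *-distribˡ-sum 2 (bitℕ ∘ c) ⟨
      2 * trueCount c                     ∎)
      where
      open ≤-Reasoning
      colours : Fin n → ℕ
      colours w = bitℕ (c (e w false)) + bitℕ (c (e w true))
      colours-uH : colours uH ≡ 2
      colours-uH rewrite uH-true false | uH-true true = refl
      colours-u : colours u ≡ 1
      colours-u rewrite ¬-not mixed = trans (+-comm (bitℕ (not (c (e u true)))) _) (bitℕ-+-not (c (e u true)))
      uH≢u : uH ≢ u
      uH≢u refl = mixed (trans (uH-true false) (sym (uH-true true)))
      ⌈half⌉ : ∀ {s} → 3 ≤ 2 * s → 2 ≤ s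
      ⌈half⌉ {zero}        ()
      ⌈half⌉ {suc zero}    (s≤s (s≤s ()))
      ⌈half⌉ {suc (suc s)} _ = s≤s (s≤s z≤n)

    successors-agree : m ≤ 3 → (∀ v → indegree v ≡ 2) → (c : Fin m → Bool) →
      ∃[ uL ] (∀ b → c (e uL b) ≡ false) → ∃[ uH ] (∀ b → c (e uH b) ≡ true) →
      ∀ u → c (e u false) ≡ c (e u true)
    successors-agree m≤3 indegree≡2 c (uL , uL-false) (uH , uH-true) u
      with c (e u false) Bool.≟ c (e u true)
    ... | yes agree = agree
    ... | no mixed  = contradiction m≤3 (<⇒≱ (begin
      4                                 ≤⟨ +-mono-≤ (2≤trueCount indegree≡2 c uH-true mixed)
                                                    (2≤trueCount indegree≡2 (not ∘ c) (cong not ∘ uL-false)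
                                                                 (mixed ∘ not-injective)) ⟩
      trueCount c + trueCount (not ∘ c) ≡⟨ trueCount-+-not c ⟩
      m                                 ∎))
      where open ≤-Reasoning

open Counting

open import Data.Fin.Induction using (<-weakInduction)
open import Data.Integer as ℤ using (+_)
import Data.Integer.Properties as ℤₚ
open import Data.List using ([]; _∷_; map; filter; length)
open import Data.List.Properties using (filter-++; length-++)
open import Data.Nat as ℕ using (ℕ; zero; suc)
import Data.Nat.Coprimality as Coprime
import Data.Nat.Properties as ℕₚ
open import Algebra.Properties.Semiring.Sum ℕₚ.+-*-semiring using (sum)
open import Data.Rational hiding (_≟_)
open import Data.Rational.Properties renaming (_≟_ to _≟ℚ_)
open import Data.Sum using (_⊎_; inj₁; inj₂; [_,_]′)
open import Level using (0ℓ)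
open import Relation.Binary.Definitions using (tri<; tri≈; tri>)
open import Relation.Nullary using (¬_; Dec; does; yes; no; contradiction)
open import Relation.Nullary.Decidable using (dec-true; dec-false; dec⇒maybe)
open import Relation.Unary using (Decidable)
open import Tactic.RingSolver using (solve-∀)
open import Tactic.RingSolver.Core.AlmostCommutativeRing using (AlmostCommutativeRing; fromCommutativeRing)

ℚ-ring : AlmostCommutativeRing 0ℓ 0ℓ
ℚ-ring = fromCommutativeRing +-*-commutativeRing (λ q → dec⇒maybe (0ℚ ≟ℚ q))

mean : ℚ → ℚ → ℚ
mean a b = ½ * (a + b)

mean-comm : ∀ a b → mean a b ≡ mean b a
mean-comm a b = cong (½ *_) (+-comm a b)

mean-idem : ∀ a → ½ * (a + a) ≡ a
mean-idem = solve-∀ ℚ-ring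

≤⇒≤-mean : ∀ {a b} → a ≤ b → a ≤ mean a b
≤⇒≤-mean {a} {b} a≤b = subst (_≤ mean a b) (mean-idem a) (*-monoˡ-≤-nonNeg ½ (+-monoʳ-≤ a a≤b))

≤⇒mean-≤ : ∀ {a b} → a ≤ b → mean a b ≤ b
≤⇒mean-≤ {a} {b} a≤b = subst (mean a b ≤_) (mean-idem b) (*-monoˡ-≤-nonNeg ½ (+-monoˡ-≤ b a≤b))

min-≤-mean : ∀ a b → a ≤ mean a b ⊎ b ≤ mean a b
min-≤-mean a b with ≤-total a b
... | inj₁ a≤b = inj₁ (≤⇒≤-mean a≤b)
... | inj₂ b≤a = inj₂ (subst (b ≤_) (mean-comm b a) (≤⇒≤-mean b≤a))

mean-≤-max : ∀ a b → mean a b ≤ a ⊎ mean a b ≤ b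
mean-≤-max a b with ≤-total a b
... | inj₁ a≤b = inj₂ (≤⇒mean-≤ a≤b)
... | inj₂ b≤a = inj₁ (subst (_≤ a) (mean-comm b a) (≤⇒mean-≤ b≤a))

mean-≤-either : ∀ {a b c} → mean a b ≤ c → a ≤ c ⊎ b ≤ c
mean-≤-either {a} {b} m≤c with min-≤-mean a b
... | inj₁ a≤m = inj₁ (≤-trans a≤m m≤c)
... | inj₂ b≤m = inj₂ (≤-trans b≤m m≤c)

≤-mean-either : ∀ {a b c} → c ≤ mean a b → c ≤ a ⊎ c ≤ b
≤-mean-either {a} {b} c≤m with mean-≤-max a b
... | inj₁ m≤a = inj₁ (≤-trans c≤m m≤a)
... | inj₂ m≤b = inj₂ (≤-trans c≤m m≤b)

≤-mean : ∀ {a b c} → c ≤ a → c ≤ b → c ≤ mean a b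
≤-mean {a} {b} c≤a c≤b with min-≤-mean a b
... | inj₁ a≤m = ≤-trans c≤a a≤m
... | inj₂ b≤m = ≤-trans c≤b b≤m

mean-≤ : ∀ {a b c} → a ≤ c → b ≤ c → mean a b ≤ c
mean-≤ {a} {b} a≤c b≤c with mean-≤-max a b
... | inj₁ m≤a = ≤-trans m≤a a≤c
... | inj₂ m≤b = ≤-trans m≤b b≤c

twice-mean : ∀ a b → a + b ≡ ½ * (a + b) + ½ * (a + b)
twice-mean = solve-∀ ℚ-ring

mean-≤⇒≤-double : ∀ {a b c} → 0ℚ ≤ b → mean a b ≤ c → a ≤ c + c
mean-≤⇒≤-double {a} {b} {c} 0≤b m≤c = begin
  a                    ≡⟨ +-identityʳ a ⟨
  a + 0ℚ               ≤⟨ +-monoʳ-≤ a 0≤b ⟩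
  a + b                ≡⟨ twice-mean a b ⟩
  mean a b + mean a b  ≤⟨ +-mono-≤ m≤c m≤c ⟩
  c + c                ∎
  where open ≤-Reasoning

≤-mean⇒double-≤ : ∀ {a b c} → b ≤ 1ℚ → c ≤ mean a b → (c + c) - 1ℚ ≤ a
≤-mean⇒double-≤ {a} {b} {c} b≤1 c≤m = begin
  (c + c) - 1ℚ               ≤⟨ +-monoˡ-≤ (- 1ℚ) (+-mono-≤ c≤m c≤m) ⟩
  (mean a b + mean a b) - 1ℚ ≡⟨ cong (_- 1ℚ) (twice-mean a b) ⟨
  (a + b) - 1ℚ               ≤⟨ +-monoˡ-≤ (- 1ℚ) (+-monoʳ-≤ a b≤1) ⟩
  (a + 1ℚ) - 1ℚ              ≡⟨ cancel a ⟩
  a                          ∎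
  where
  open ≤-Reasoning
  cancel : ∀ a → (a + 1ℚ) - 1ℚ ≡ a
  cancel = solve-∀ ℚ-ring

isHigh : ℚ → Bool
isHigh q = does (½ ≤? q)

isHigh-mean : ∀ {a b} → isHigh a ≡ isHigh b → isHigh (mean a b) ≡ isHigh a
isHigh-mean {a} {b} = by-cases (½ ≤? a) (½ ≤? b)
  where
  by-cases : (½≤a? : Dec (½ ≤ a)) (½≤b? : Dec (½ ≤ b)) →
    does ½≤a? ≡ does ½≤b? → isHigh (mean a b) ≡ does ½≤a?
  by-cases (yes ½≤a) (yes ½≤b) _ = dec-true (½ ≤? mean a b) (≤-mean ½≤a ½≤b)
  by-cases (no ½≰a)  (no ½≰b)  _ = dec-false (½ ≤? mean a b) ([ ½≰a , ½≰b ]′ ∘ ≤-mean-either)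
  by-cases (yes _)   (no _)    ()
  by-cases (no _)    (yes _)   ()

NearZero NearOne : ℚ → Set
NearZero q = q ≤ + 1 / 100
NearOne  q = + 99 / 100 ≤ q

square-pos : ∀ {x} → x ≢ 0ℚ → Positive (x * x)
square-pos {x} x≢0 with <-cmp x 0ℚ
... | tri< x<0 _ _ = neg*neg⇒pos x {{negative x<0}} x {{negative x<0}}
... | tri≈ _ x≡0 _ = contradiction x≡0 x≢0
... | tri> _ _ x>0 = pos*pos⇒pos x {{positive x>0}} x {{positive x>0}}

square-nonNeg : ∀ x → NonNegative (x * x)
square-nonNeg x with x ≟ℚ 0ℚ
... | yes refl = _
... | no x≢0   = pos⇒nonNeg (x * x) {{square-pos x≢0}}

sq-≤-sq⇒≤ : ∀ {c d} → 0ℚ ≤ d → c * c ≤ d * d → c ≤ d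
sq-≤-sq⇒≤ {c} {d} 0≤d cc≤dd with c ≤? d
... | yes c≤d = c≤d
... | no c≰d  = contradiction (begin-strict
  c * c  ≤⟨ cc≤dd ⟩
  d * d  ≤⟨ *-monoˡ-≤-nonNeg d {{nonNegative 0≤d}} (<⇒≤ d<c) ⟩
  d * c  <⟨ *-monoˡ-<-pos c {{positive (≤-<-trans 0≤d d<c)}} d<c ⟩
  c * c  ∎) (<-irrefl refl)
  where
  open ≤-Reasoning
  d<c = ≰⇒> c≰d

gap⇒extremes : ∀ {p q c} → 0ℚ ≤ q → p ≤ 1ℚ → c ≤ p - q → q ≤ 1ℚ - c × c ≤ p
gap⇒extremes {p} {q} {c} 0≤q p≤1 c≤p-q = q≤1-c , c≤p
  where
  open ≤-Reasoning
  split : ∀ p q → p ≡ (p - q) + q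
  split = solve-∀ ℚ-ring
  unsplit : ∀ p q → q ≡ p + - (p - q)
  unsplit = solve-∀ ℚ-ring
  c≤p : c ≤ p
  c≤p = begin
    c              ≤⟨ c≤p-q ⟩
    p - q          ≡⟨ +-identityʳ (p - q) ⟨
    (p - q) + 0ℚ   ≤⟨ +-monoʳ-≤ (p - q) 0≤q ⟩
    (p - q) + q    ≡⟨ split p q ⟨
    p              ∎
  q≤1-c : q ≤ 1ℚ - c
  q≤1-c = begin
    q              ≡⟨ unsplit p q ⟩
    p + - (p - q)  ≤⟨ +-mono-≤ p≤1 (neg-antimono-≤ c≤p-q) ⟩
    1ℚ - c         ∎

second≡ : ∀ {s} (x : Fin 2 → ℚ) → sumℚ x ≡ s → x (suc zero) ≡ s - x zero
second≡ {s} x sum≡s = trans (isolate (x zero) (x (suc zero))) (cong (_- x zero) sum≡s)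
  where
  isolate : ∀ a b → b ≡ (a + (b + 0ℚ)) - a
  isolate = solve-∀ ℚ-ring

normSq-rowTimes-2×2 : (E : Fin 2 → Fin 2 → ℚ) → (∀ u → sumℚ (E u) ≡ 1ℚ) →
  (x : Fin 2 → ℚ) → sumℚ x ≡ 0ℚ →
  normSq (rowTimes x E) ≡ normSq x * ((E zero zero - E (suc zero) zero) * (E zero zero - E (suc zero) zero))
normSq-rowTimes-2×2 E rows x x-sum =
  substituted (x zero) (x (suc zero)) (E zero zero) (E zero (suc zero)) (E (suc zero) zero) (E (suc zero) (suc zero))
    (second≡ x x-sum) (second≡ (E zero) (rows zero)) (second≡ (E (suc zero)) (rows (suc zero)))
  where
  identity : ∀ x₀ p q →
    (x₀ * p + ((0ℚ - x₀) * q + 0ℚ)) * (x₀ * p + ((0ℚ - x₀) * q + 0ℚ)) +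
    ((x₀ * (1ℚ - p) + ((0ℚ - x₀) * (1ℚ - q) + 0ℚ)) * (x₀ * (1ℚ - p) + ((0ℚ - x₀) * (1ℚ - q) + 0ℚ)) + 0ℚ)
    ≡ (x₀ * x₀ + ((0ℚ - x₀) * (0ℚ - x₀) + 0ℚ)) * ((p - q) * (p - q))
  identity = solve-∀ ℚ-ring
  substituted : ∀ x₀ x₁ p p′ q q′ → x₁ ≡ 0ℚ - x₀ → p′ ≡ 1ℚ - p → q′ ≡ 1ℚ - q →
    (x₀ * p + (x₁ * q + 0ℚ)) * (x₀ * p + (x₁ * q + 0ℚ)) +
    ((x₀ * p′ + (x₁ * q′ + 0ℚ)) * (x₀ * p′ + (x₁ * q′ + 0ℚ)) + 0ℚ)
    ≡ (x₀ * x₀ + (x₁ * x₁ + 0ℚ)) * ((p - q) * (p - q))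
  substituted x₀ _ p _ q _ refl refl refl = identity x₀ p q

first≤1 : (r : Fin 2 → ℚ) → 0ℚ ≤ r (suc zero) → sumℚ r ≡ 1ℚ → r zero ≤ 1ℚ
first≤1 r 0≤r₁ r-sum = begin
  r zero                       ≡⟨ +-identityʳ (r zero) ⟨
  r zero + 0ℚ                  ≤⟨ +-monoʳ-≤ (r zero) (+-monoˡ-≤ 0ℚ 0≤r₁) ⟩
  r zero + (r (suc zero) + 0ℚ) ≡⟨ r-sum ⟩
  1ℚ                           ∎
  where open ≤-Reasoning

p≤q⇒0≤q-p : ∀ {p q} → p ≤ q → 0ℚ ≤ q - p
p≤q⇒0≤q-p {p} {q} p≤q = subst (_≤ q - p) (+-inverseʳ p) (+-monoˡ-≤ (- p) p≤q)

separated-column : ∀ {n m} → n ≡ 2 → m ≡ 2 → (E : Fin n → Fin m → ℚ) →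
  (∀ u v → 0ℚ ≤ E u v) → (∀ u → sumℚ (E u) ≡ 1ℚ) →
  (x : Fin n → ℚ) → sumℚ x ≡ 0ℚ → ¬ (∀ i → x i ≡ 0ℚ) →
  + 9801 / 10000 * normSq x ≤ normSq (rowTimes x E) →
  ∃[ t ] ∃[ uL ] ∃[ uH ] (NearZero (E uL t) × NearOne (E uH t))
separated-column refl refl E nonNeg rows x x-sum x≢0 expands = by-order (≤-total (E (suc zero) zero) (E zero zero))
  where
  open ≤-Reasoning
  gap² : Fin 2 → Fin 2 → ℚ
  gap² u w = (E u zero - E w zero) * (E u zero - E w zero)
  gap²-sym : ∀ a b → (a - b) * (a - b) ≡ (b - a) * (b - a)
  gap²-sym = solve-∀ ℚ-ring
  x₀≢0 : x zero ≢ 0ℚ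
  x₀≢0 x₀≡0 = x≢0 λ { zero → x₀≡0 ; (suc zero) → trans (second≡ x x-sum) (cong (λ a → 0ℚ - a) x₀≡0) }
  instance
    normSq-pos : Positive (normSq x)
    normSq-pos = pos+nonNeg⇒pos (x zero * x zero) {{square-pos x₀≢0}} (x (suc zero) * x (suc zero) + 0ℚ)
      {{nonNeg+nonNeg⇒nonNeg (x (suc zero) * x (suc zero)) {{square-nonNeg (x (suc zero))}} 0ℚ}}
  0·99²≤gap² : + 9801 / 10000 ≤ gap² zero (suc zero)
  0·99²≤gap² = *-cancelˡ-≤-pos (normSq x) (begin
    normSq x * (+ 9801 / 10000)     ≡⟨ *-comm (normSq x) _ ⟩
    + 9801 / 10000 * normSq x       ≤⟨ expands ⟩
    normSq (rowTimes x E)           ≡⟨ normSq-rowTimes-2×2 E rows x x-sum ⟩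
    normSq x * gap² zero (suc zero) ∎)
  extremes : ∀ uH uL → E uL zero ≤ E uH zero → + 9801 / 10000 ≤ gap² uH uL →
    NearZero (E uL zero) × NearOne (E uH zero)
  extremes uH uL low≤high 0·99²≤ = gap⇒extremes (nonNeg uL zero) (first≤1 (E uH) (nonNeg uH (suc zero)) (rows uH))
    (sq-≤-sq⇒≤ {+ 99 / 100} (p≤q⇒0≤q-p low≤high) 0·99²≤)
  by-order : E (suc zero) zero ≤ E zero zero ⊎ E zero zero ≤ E (suc zero) zero →
    ∃[ t ] ∃[ uL ] ∃[ uH ] (NearZero (E uL t) × NearOne (E uH t))
  by-order (inj₁ q≤p) = zero , suc zero , zero , extremes zero (suc zero) q≤p 0·99²≤gap²
  by-order (inj₂ p≤q) = zero , zero , suc zero ,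
    extremes (suc zero) zero p≤q (subst (_ ≤_) (gap²-sym (E zero zero) (E (suc zero) zero)) 0·99²≤gap²)

ℕtoℚ≡mkℚ : ∀ n → ℕtoℚ n ≡ mkℚ (+ n) 0 (Coprime.sym (Coprime.1-coprimeTo n))
ℕtoℚ≡mkℚ n = normalize-coprime (Coprime.sym (Coprime.1-coprimeTo n))

ℕtoℚ-+ : ∀ a b → ℕtoℚ (a ℕ.+ b) ≡ ℕtoℚ a + ℕtoℚ b
ℕtoℚ-+ a b = begin
  + (a ℕ.+ b) / 1                   ≡⟨ cong (_/ 1) (cong₂ ℤ._+_ (ℤₚ.*-identityʳ (+ a)) (ℤₚ.*-identityʳ (+ b))) ⟨
  (+ a ℤ.* + 1 ℤ.+ + b ℤ.* + 1) / 1 ≡⟨ cong₂ _+_ (ℕtoℚ≡mkℚ a) (ℕtoℚ≡mkℚ b) ⟨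
  ℕtoℚ a + ℕtoℚ b                   ∎
  where open ≡-Reasoning

ℕtoℚ-injective : ∀ {a b} → ℕtoℚ a ≡ ℕtoℚ b → a ≡ b
ℕtoℚ-injective {a} {b} eq = ℤₚ.+-injective (cong ↥_ (trans (sym (ℕtoℚ≡mkℚ a)) (trans eq (ℕtoℚ≡mkℚ b))))

sumℚ-cong : ∀ {n} {f g : Fin n → ℚ} → (∀ i → f i ≡ g i) → sumℚ f ≡ sumℚ g
sumℚ-cong {zero}  f≗g = refl
sumℚ-cong {suc n} f≗g = cong₂ _+_ (f≗g zero) (sumℚ-cong (f≗g ∘ suc))

sumℚ-ℕtoℚ : ∀ {n} (f : Fin n → ℕ) → sumℚ (ℕtoℚ ∘ f) ≡ ℕtoℚ (sum f)
sumℚ-ℕtoℚ {zero}  f = refl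
sumℚ-ℕtoℚ {suc n} f = trans (cong (λ s → ℕtoℚ (f zero) + s) (sumℚ-ℕtoℚ (f ∘ suc))) (sym (ℕtoℚ-+ (f zero) _))

sumℚ-*ʳ : ∀ {n} (f : Fin n → ℚ) c → sumℚ (λ i → f i * c) ≡ sumℚ f * c
sumℚ-*ʳ {zero}  f c = sym (*-zeroˡ c)
sumℚ-*ʳ {suc n} f c = trans (cong (λ s → f zero * c + s) (sumℚ-*ʳ (f ∘ suc) c)) (sym (*-distribʳ-+ c (f zero) _))

sumℚ-mean : ∀ {n} (f g : Fin n → ℚ) → sumℚ (λ i → mean (f i) (g i)) ≡ mean (sumℚ f) (sumℚ g)
sumℚ-mean {zero}  f g = refl
sumℚ-mean {suc n} f g =
  trans (cong (λ s → mean (f zero) (g zero) + s) (sumℚ-mean (f ∘ suc) (g ∘ suc))) (mean-+ (f zero) (g zero) _ _)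
  where
  mean-+ : ∀ a b c d → ½ * (a + b) + ½ * (c + d) ≡ ½ * ((a + c) + (b + d))
  mean-+ = solve-∀ ℚ-ring

indegree≡2 : ∀ {n m} (e : Fin n → Bool → Fin m) →
  (∀ v → sumℚ (λ u → ℕtoℚ (edgesBetween e u v) * ½) ≡ 1ℚ) → ∀ v → indegree e v ≡ 2
indegree≡2 e column-sum v = ℕtoℚ-injective (begin
  ℕtoℚ (indegree e v)                                    ≡⟨ halve-double _ ⟩
  ℕtoℚ (indegree e v) * ½ * (+ 2 / 1)                    ≡⟨ cong (λ s → s * ½ * (+ 2 / 1)) (sumℚ-ℕtoℚ (λ u → edgesBetween e u v)) ⟨
  sumℚ (λ u → ℕtoℚ (edgesBetween e u v)) * ½ * (+ 2 / 1) ≡⟨ cong (_* (+ 2 / 1)) (sumℚ-*ʳ (λ u → ℕtoℚ (edgesBetween e u v)) ½) ⟨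
  sumℚ (λ u → ℕtoℚ (edgesBetween e u v) * ½) * (+ 2 / 1) ≡⟨ cong (_* (+ 2 / 1)) (column-sum v) ⟩
  ℕtoℚ 2                                                 ∎)
  where
  open ≡-Reasoning
  halve-double : ∀ q → q ≡ q * ½ * (+ 2 / 1)
  halve-double = solve-∀ ℚ-ring

length-filter-map : ∀ {A B : Set} {P : B → Set} (P? : Decidable P) (f : A → B) xs →
  length (filter P? (map f xs)) ≡ length (filter (P? ∘ f) xs)
length-filter-map P? f []       = refl
length-filter-map P? f (x ∷ xs) with does (P? (f x))
... | true  = cong suc (length-filter-map P? f xs)
... | false = length-filter-map P? f xs

reachProb : ∀ {d} (D : OBP d) → Fin (width D (fromℕ d)) → (j : Fin (suc d)) → Fin (width D j) → ℚ
reachProb {zero}  D t zero    w = ℕtoℚ (δ w t)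
reachProb {suc d} D t zero    w =
  mean (reachProb (tailOBP D) t zero (edge D zero w false)) (reachProb (tailOBP D) t zero (edge D zero w true))
reachProb {suc d} D t (suc j) w = reachProb (tailOBP D) t j w

reachProb-step : ∀ {d} (D : OBP d) t i u → reachProb D t (inject₁ i) u ≡
  mean (reachProb D t (suc i) (edge D i u false)) (reachProb D t (suc i) (edge D i u true))
reachProb-step {suc d} D t zero    u = refl
reachProb-step {suc d} D t (suc i) u = reachProb-step (tailOBP D) t i u

reachProb-∈[0,1] : ∀ {d} (D : OBP d) t j w → 0ℚ ≤ reachProb D t j w × reachProb D t j w ≤ 1ℚ
reachProb-∈[0,1] {zero}  D t zero w with does (w ≟ t)
... | true  = ≤ᵇ⇒≤ _ , ≤-refl
... | false = ≤-refl , ≤ᵇ⇒≤ _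
reachProb-∈[0,1] {suc d} D t zero w =
  ≤-mean (proj₁ (successor false)) (proj₁ (successor true)) ,
  mean-≤ (proj₂ (successor false)) (proj₂ (successor true))
  where successor = λ b → reachProb-∈[0,1] (tailOBP D) t zero (edge D zero w b)
reachProb-∈[0,1] {suc d} D t (suc j) w = reachProb-∈[0,1] (tailOBP D) t j w

sum-reachProb : ∀ {d} (D : OBP d) u → sumℚ (λ t → reachProb D t zero u) ≡ 1ℚ
sum-reachProb {zero}  D u = begin
  sumℚ (λ t → ℕtoℚ (δ u t))    ≡⟨ sumℚ-ℕtoℚ (δ u) ⟩
  ℕtoℚ (sum (δ u))             ≡⟨ cong ℕtoℚ (sum-δ u) ⟩
  1ℚ                           ∎
  where open ≡-Reasoning
sum-reachProb {suc d} D u =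
  trans (sumℚ-mean (λ t → reachProb (tailOBP D) t zero (edge D zero u false))
                   (λ t → reachProb (tailOBP D) t zero (edge D zero u true)))
        (cong₂ mean (sum-reachProb (tailOBP D) _) (sum-reachProb (tailOBP D) _))

countRuns : ∀ {d} (D : OBP d) → Fin (width D zero) → Fin (width D (fromℕ d)) → ℕ
countRuns {d} D u t = length (filter (λ x → run D x u ≟ t) (allBits d))

countRuns-step : ∀ {d} (D : OBP (suc d)) u t → countRuns D u t ≡
  countRuns (tailOBP D) (edge D zero u false) t ℕ.+ countRuns (tailOBP D) (edge D zero u true) t
countRuns-step {d} D u t =
  trans (cong length (filter-++ runs? (map _ (allBits d)) (map _ (allBits d))))
        (trans (length-++ (filter runs? (map _ (allBits d))))
               (cong₂ ℕ._+_ (length-filter-map runs? _ (allBits d)) (length-filter-map runs? _ (allBits d))))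
  where
  runs? = λ x → run D x u ≟ t

expectedMatrix≡reachProb : ∀ {d} (D : OBP d) u t → expectedMatrix D u t ≡ reachProb D t zero u
expectedMatrix≡reachProb {zero} D u t with does (u ≟ t)
... | true  = refl
... | false = refl
expectedMatrix≡reachProb {suc d} D u t = begin
  ℕtoℚ (countRuns D u t) * (½ * half^ d)             ≡⟨ cong (λ n → ℕtoℚ n * (½ * half^ d)) (countRuns-step D u t) ⟩
  ℕtoℚ (runs₀ ℕ.+ runs₁) * (½ * half^ d)             ≡⟨ cong (_* (½ * half^ d)) (ℕtoℚ-+ runs₀ runs₁) ⟩
  (ℕtoℚ runs₀ + ℕtoℚ runs₁) * (½ * half^ d)          ≡⟨ distribute (ℕtoℚ runs₀) (ℕtoℚ runs₁) (half^ d) ⟩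
  mean (ℕtoℚ runs₀ * half^ d) (ℕtoℚ runs₁ * half^ d) ≡⟨ cong₂ mean (expectedMatrix≡reachProb (tailOBP D) _ t)
                                                                   (expectedMatrix≡reachProb (tailOBP D) _ t) ⟩
  reachProb D t zero u                               ∎
  where
  open ≡-Reasoning
  runs₀ = countRuns (tailOBP D) (edge D zero u false) t
  runs₁ = countRuns (tailOBP D) (edge D zero u true) t
  distribute : ∀ a b h → (a + b) * (½ * h) ≡ ½ * (a * h + b * h)
  distribute = solve-∀ ℚ-ring

expectedMatrix-nonNeg : ∀ {d} (D : OBP d) u t → 0ℚ ≤ expectedMatrix D u t
expectedMatrix-nonNeg D u t = subst (0ℚ ≤_) (sym (expectedMatrix≡reachProb D u t)) (proj₁ (reachProb-∈[0,1] D t zero u))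

sum-expectedMatrix : ∀ {d} (D : OBP d) u → sumℚ (expectedMatrix D u) ≡ 1ℚ
sum-expectedMatrix D u = trans (sumℚ-cong (expectedMatrix≡reachProb D u)) (sum-reachProb D u)

propagate : ∀ {d} (D : OBP d) t (P : ℚ → Set) → (∀ {a b} → P (mean a b) → P a ⊎ P b) →
  ∃[ w ] P (reachProb D t zero w) → ∀ j → ∃[ w ] P (reachProb D t j w)
propagate D t P split start = <-weakInduction (λ j → ∃[ w ] P (reachProb D t j w)) start step
  where
  step : ∀ i → ∃[ w ] P (reachProb D t (inject₁ i) w) → ∃[ w ] P (reachProb D t (suc i) w)
  step i (u , Pu) with split (subst P (reachProb-step D t i u) Pu)
  ... | inj₁ P₀ = edge D i u false , P₀
  ... | inj₂ P₁ = edge D i u true  , P₁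

-- ≤⇒≤ᵇ turns an inequality between rational literals that is false into T false, i.e. ⊥.
nearZero⇒¬isHigh : ∀ {q} → NearZero q → isHigh q ≡ false
nearZero⇒¬isHigh {q} small = dec-false (½ ≤? q) (λ ½≤q → ≤⇒≤ᵇ (≤-trans ½≤q small))

nearOne⇒isHigh : ∀ {q} → NearOne q → isHigh q ≡ true
nearOne⇒isHigh {q} large = dec-true (½ ≤? q) (≤-trans (≤ᵇ⇒≤ _) large)

successors-¬isHigh : (s : Bool → ℚ) → (∀ b → 0ℚ ≤ s b) → NearZero (mean (s false) (s true)) →
  ∀ b → isHigh (s b) ≡ false
successors-¬isHigh s nonNeg small false =
  dec-false (½ ≤? s false) (λ ½≤s → ≤⇒≤ᵇ (≤-trans ½≤s (mean-≤⇒≤-double (nonNeg true) small)))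
successors-¬isHigh s nonNeg small true =
  successors-¬isHigh (s ∘ not) (nonNeg ∘ not) (subst NearZero (mean-comm (s false) (s true)) small) false

successors-isHigh : (s : Bool → ℚ) → (∀ b → s b ≤ 1ℚ) → NearOne (mean (s false) (s true)) →
  ∀ b → isHigh (s b) ≡ true
successors-isHigh s ≤1 large false =
  dec-true (½ ≤? s false) (≤-trans (≤ᵇ⇒≤ _) (≤-mean⇒double-≤ (≤1 true) large))
successors-isHigh s ≤1 large true =
  successors-isHigh (s ∘ not) (≤1 ∘ not) (subst NearOne (mean-comm (s false) (s true)) large) false

reachColouring : ∀ {d} (D : OBP d) → Fin (width D (fromℕ d)) → Colouring D
reachColouring D t j w = isHigh (reachProb D t j w)

module _ {d} (D : OBP d) (t : Fin (width D (fromℕ d)))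
         (nearZeros : ∀ j → ∃[ w ] NearZero (reachProb D t j w))
         (nearOnes  : ∀ j → ∃[ w ] NearOne (reachProb D t j w)) where

  both-colours : BothInEveryLayer D (reachColouring D t)
  both-colours j = (proj₁ (nearOnes j)  , nearOne⇒isHigh (proj₂ (nearOnes j))) ,
                   (proj₁ (nearZeros j) , nearZero⇒¬isHigh (proj₂ (nearZeros j)))

  regular-layer-uncut : Is3OBP D → ∀ i → Regular D i → LayerUncut D (reachColouring D t) i
  regular-layer-uncut is3 i (_ , _ , _ , column-sums) u b = begin
    isHigh (reachProb D t (inject₁ i) u)         ≡⟨ cong isHigh (reachProb-step D t i u) ⟩
    isHigh (mean (ρ (e u false)) (ρ (e u true))) ≡⟨ isHigh-mean {ρ (e u false)} {ρ (e u true)} agree ⟩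
    isHigh (ρ (e u false))                       ≡⟨ same-colour b ⟩
    isHigh (ρ (e u b))                           ∎
    where
    open ≡-Reasoning
    e = edge D i
    ρ = reachProb D t (suc i)
    successors : Fin (width D (inject₁ i)) → Bool → ℚ
    successors w b = ρ (e w b)
    low : ∃[ uL ] (∀ b → isHigh (ρ (e uL b)) ≡ false)
    low = uL , successors-¬isHigh (successors uL) (λ b → proj₁ (reachProb-∈[0,1] D t (suc i) (e uL b)))
                                  (subst NearZero (reachProb-step D t i uL) (proj₂ (nearZeros (inject₁ i))))
      where uL = proj₁ (nearZeros (inject₁ i))
    high : ∃[ uH ] (∀ b → isHigh (ρ (e uH b)) ≡ true)
    high = uH , successors-isHigh (successors uH) (λ b → proj₂ (reachProb-∈[0,1] D t (suc i) (e uH b)))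
                                  (subst NearOne (reachProb-step D t i uH) (proj₂ (nearOnes (inject₁ i))))
      where uH = proj₁ (nearOnes (inject₁ i))
    agree : isHigh (ρ (e u false)) ≡ isHigh (ρ (e u true))
    agree = successors-agree e (is3 (suc i)) (indegree≡2 e column-sums) (isHigh ∘ ρ) low high u
    same-colour : ∀ b → isHigh (ρ (e u false)) ≡ isHigh (ρ (e u b))
    same-colour false = refl
    same-colour true  = agree

reach-partition : ∀ {d} k (D : OBP d) → Is3OBP D → AtMostNonRegular k D →
  ∃[ t ] ∃[ uL ] ∃[ uH ] (NearZero (expectedMatrix D uL t) × NearOne (expectedMatrix D uH t)) →
  ∃[ c ] (BothInEveryLayer D c × AtMostCutLayers D c k)
reach-partition k D is3 (S , |S|≤k , regular) (t , uL , uH , small , large) =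
  reachColouring D t , both-colours D t nearZeros nearOnes ,
  S , |S|≤k , λ i i∉S → regular-layer-uncut D t nearZeros nearOnes is3 i (regular i i∉S)
  where
  nearZeros : ∀ j → ∃[ w ] NearZero (reachProb D t j w)
  nearZeros = propagate D t NearZero mean-≤-either (uL , subst NearZero (expectedMatrix≡reachProb D uL t) small)
  nearOnes : ∀ j → ∃[ w ] NearOne (reachProb D t j w)
  nearOnes = propagate D t NearOne ≤-mean-either (uH , subst NearOne (expectedMatrix≡reachProb D uH t) large)

lemma3p13 : (d k : ℕ) (D : OBP d) → Is3OBP D → AtMostNonRegular k D →
    width D zero ≡ 2 → width D (fromℕ d) ≡ 2 →
    LambdaAtLeast099 D → LambdaAtMost1 D →
    ∃[ c ] (BothInEveryLayer D c × AtMostCutLayers D c (2 ℕ.* k ℕ.+ 1))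
lemma3p13 d k D is3 nonRegular width₀≡2 width_d≡2 (x , x-sum , x≢0 , expands) _ =
  weaken (reach-partition k D is3 nonRegular
    (separated-column width₀≡2 width_d≡2 (expectedMatrix D) (expectedMatrix-nonNeg D) (sum-expectedMatrix D)
                      x x-sum x≢0 expands))
  where
  weaken : ∃[ c ] (BothInEveryLayer D c × AtMostCutLayers D c k) →
           ∃[ c ] (BothInEveryLayer D c × AtMostCutLayers D c (2 ℕ.* k ℕ.+ 1))
  weaken (c , both , S , |S|≤k , uncut) =
    c , both , S , ℕₚ.≤-trans |S|≤k (ℕₚ.≤-trans (ℕₚ.m≤n*m k 2) (ℕₚ.m≤m+n (2 ℕ.* k) 1)) , uncut
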